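{- Let $n\geq 4$ be an integer, $a=f_n^2$, $b=f_{n+1}^2$, $c=f_{n+2}^2$, and let $\ell$ be the least non-negative integer with $\ell b\equiv c\pmod a$. Define $q=\left\lfloor \frac{a}{a-\ell}\right\rfloor$, $r=a-q(a-\ell)$, $\overline{q}=\left\lfloor \frac{a}{\ell}\right\rfloor$, $\overline{r}=a-\overline{q}\ell$. If $n$ is even, then $q=1$, $r=\ell$, \[ \overline{q}=\begin{cases}2,& n=4,\\ 3,& n=6,\\ 4,& n\geq 8,\end{cases}\qquad \overline{r}=\begin{cases}1,& n=4,\\ 13,& n=6,\\ f_nf_{n-6}-4,& n\geq 8.\end{cases}\] If $n$ is odd, then \[ q=\begin{cases}6,& n=5,\\ 4,& n\geq 7,\end{cases}\qquad r=\begin{cases}1,& n=5,\\ f_nf_{n-6}+4,& n\geq 7,\end{cases}\] $\overline{q}=1$ and $\overline{r}=f_nf_{n-3}-1$.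
   Context: The Fibonacci numbers are defined by $f_0=0$, $f_1=1$, $f_k=f_{k-1}+f_{k-2}$ for $k\geq 2$. -}

module Defs where

open import Data.Nat using (ℕ; zero; suc; _+_; _*_; _∸_; _^_; _<_; _/_; _%_)
open import Relation.Binary.PropositionalEquality using (_≡_; _≢_)
open import Data.Product using (_×_)
open import Relation.Nullary using (¬_)

fib : ℕ → ℕ
fib zero = 0
fib (suc zero) = 1
fib (suc (suc k)) = fib (suc k) + fib k

CongMod : ℕ → ℕ → ℕ → Set
CongMod zero x y = x ≡ y
CongMod (suc m) x y = x % suc m ≡ y % suc m

IsLeastSol : ℕ → ℕ → ℕ → ℕ → Set
IsLeastSol a b c ℓ = CongMod a (ℓ * b) c × (∀ m → m < ℓ → ¬ (CongMod a (m * b) c))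

-- floor division ⌊x / y⌋ for y > 0 (the value at y = 0 is an arbitrary
-- convention, 0; it is never used, since the divisors below are positive)
floorDiv : ℕ → ℕ → ℕ
floorDiv x zero = 0
floorDiv x (suc k) = x / suc k

{-# OPTIONS --safe #-}

-- Write x = Fₙ, so a = x². Cassini's identity Fₙ₋₁Fₙ₊₁ = x² + (−1)ⁿ gives
-- b ≡ xFₙ₋₁ + (−1)ⁿ and c ≡ 3xFₙ₋₁ + (−1)ⁿ modulo a. Using x + Fₙ₋₃ = 2Fₙ₋₁ for even n
-- and x = Fₙ₋₁ + Fₙ₋₂ for odd n, one checks that ℓ = 1 + xFₙ₋₃, resp. ℓ = 1 + 2xFₙ₋₂,
-- solves ℓb ≡ c; it is the least solution since ℓ < a and gcd(a, b) = 1.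
-- The quotients come from x = 4Fₙ₋₃ + Fₙ₋₆: for even n, a = 4ℓ + (xFₙ₋₆ − 4), and for
-- odd n, a − ℓ = xFₙ₋₃ − 1 and a = 4(a − ℓ) + (xFₙ₋₆ + 4). The cases n = 4, 5, 6 are
-- computed.

module Submission where

open import Defs
open import Data.Nat using (ℕ; zero; suc; _+_; _*_; _∸_; _^_; _≤_; _<_)
open import Data.Nat using (_%_)
open import Relation.Binary.PropositionalEquality using (_≡_)
open import Data.Product using (_×_)

open import Data.Nat using (NonZero; z≤n; s≤s; _/_; _≤?_)
open import Data.Nat.Properties
open import Data.Nat.DivMod
  using (m≡m%n+[m/n]*n; [m+kn]%n≡m%n; m<n⇒m%n≡m; m<n⇒m/n≡0; m*n/n≡m; +-distrib-/-∣ʳ)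
open import Data.Nat.Divisibility using (_∣_; divides; ∣-trans; n∣m*n; n∣m⇒m%n≡0)
open import Data.Nat.Coprimality using (Coprime; coprime-divisor; coprime-+; 1-coprimeTo)
  renaming (sym to coprime-sym)
open import Data.Nat.Tactic.RingSolver using (solve-∀)
open import Data.Product using (_,_)
open import Data.Empty using (⊥-elim)
open import Function.Base using (_∘_)
open import Relation.Binary.PropositionalEquality
  using (refl; sym; trans; cong; cong₂; subst; subst₂; module ≡-Reasoning)
open import Relation.Nullary using (contradiction)
open import Relation.Nullary.Decidable using (from-no)

m^2≡m*m : ∀ m → m ^ 2 ≡ m * m
m^2≡m*m m = cong (m *_) (*-identityʳ m)

<-slack : ∀ {m n} k → suc (m + k) ≡ n → m < n
<-slack {m} k refl = s≤s (m≤m+n m k)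

eliminate : ∀ {P Q X Y} R → X ≡ Y → P + R * X ≡ Q + R * Y → P ≡ Q
eliminate {P} {Q} {X} R refl eq = +-cancelʳ-≡ (R * X) P Q eq

floorDiv-unique : ∀ {n d k ρ} → n ≡ ρ + k * d → ρ < d →
                  floorDiv n d ≡ k × n ∸ floorDiv n d * d ≡ ρ
floorDiv-unique {d = suc d} {k} {ρ} refl ρ<d =
  quotient , trans (cong (λ k′ → ρ + k * suc d ∸ k′ * suc d) quotient) (m+n∸n≡m ρ (k * suc d))
  where
  quotient : (ρ + k * suc d) / suc d ≡ k
  quotient = trans (+-distrib-/-∣ʳ ρ (n∣m*n k)) (cong₂ _+_ (m<n⇒m/n≡0 ρ<d) (m*n/n≡m k (suc d)))

floorDiv-by-large-complement : ∀ {a ℓ} → ℓ + ℓ < a →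
                               floorDiv a (a ∸ ℓ) ≡ 1 × a ∸ floorDiv a (a ∸ ℓ) * (a ∸ ℓ) ≡ ℓ
floorDiv-by-large-complement {a} {ℓ} 2ℓ<a = floorDiv-unique a≡ℓ+[a∸ℓ] (m+n≤o⇒m≤o∸n (suc ℓ) 2ℓ<a)
  where
  a≡ℓ+[a∸ℓ] : a ≡ ℓ + 1 * (a ∸ ℓ)
  a≡ℓ+[a∸ℓ] = sym (trans (cong (ℓ +_) (*-identityˡ (a ∸ ℓ)))
                         (m+[n∸m]≡n (≤-trans (m≤m+n ℓ ℓ) (<⇒≤ 2ℓ<a))))

floorDiv-by-complement : ∀ {a ℓ δ k ρ} → a ≡ δ + ℓ → a ≡ ρ + k * δ → ρ < δ →
                         floorDiv a (a ∸ ℓ) ≡ k × a ∸ floorDiv a (a ∸ ℓ) * (a ∸ ℓ) ≡ ρ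
floorDiv-by-complement {ℓ = ℓ} {δ} a≡δ+ℓ with refl ← trans (cong (_∸ ℓ) a≡δ+ℓ) (m+n∸n≡m δ ℓ) =
  floorDiv-unique

%≡%⇒∣∸ : ∀ {m n d} .{{_ : NonZero d}} → m % d ≡ n % d → d ∣ m ∸ n
%≡%⇒∣∸ {m} {n} {d} eq = divides (m / d ∸ n / d) (begin
  m ∸ n                                      ≡⟨ cong₂ _∸_ (m≡m%n+[m/n]*n m d) (m≡m%n+[m/n]*n n d) ⟩
  (m % d + m / d * d) ∸ (n % d + n / d * d)  ≡⟨ cong (λ k → (k + m / d * d) ∸ (n % d + n / d * d)) eq ⟩
  (n % d + m / d * d) ∸ (n % d + n / d * d)  ≡⟨ [m+n]∸[m+o]≡n∸o (n % d) _ _ ⟩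
  m / d * d ∸ n / d * d                      ≡⟨ *-distribʳ-∸ d (m / d) (n / d) ⟨
  (m / d ∸ n / d) * d                        ∎)
  where open ≡-Reasoning

coprime-*ˡ : ∀ {m n o} → Coprime m o → Coprime n o → Coprime (m * n) o
coprime-*ˡ {m} m⊥o n⊥o {d} (d∣mn , d∣o) = n⊥o (coprime-divisor d⊥m d∣mn , d∣o)
  where
  d⊥m : Coprime d m
  d⊥m (e∣d , e∣m) = m⊥o (e∣m , ∣-trans e∣d d∣o)

coprime-squares : ∀ {m n} → Coprime m n → Coprime (m * m) (n * n)
coprime-squares {m} {n} m⊥n = coprime-sym (coprime-*ˡ n⊥m² n⊥m²)
  where
  n⊥m² : Coprime n (m * m)
  n⊥m² = coprime-sym (coprime-*ˡ m⊥n m⊥n)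

least-solution-unique : ∀ {a b c ℓ} L k j → Coprime a b → IsLeastSol a b c ℓ →
                        L * b + k * a ≡ c + j * a → L < a → ℓ ≡ L
least-solution-unique {zero} _ _ _ _ _ _ ()
least-solution-unique {suc a} {b} {c} {ℓ} L k j a⊥b (ℓ-solves , ℓ-least) L-certificate L<a =
  ≤-antisym ℓ≤L (m∸n≡0⇒m≤n L∸ℓ≡0)
  where
  open ≡-Reasoning
  L-solves : CongMod (suc a) (L * b) c
  L-solves = begin
    L * b % suc a                 ≡⟨ [m+kn]%n≡m%n (L * b) k (suc a) ⟨
    (L * b + k * suc a) % suc a   ≡⟨ cong (_% suc a) L-certificate ⟩
    (c + j * suc a) % suc a       ≡⟨ [m+kn]%n≡m%n c j (suc a) ⟩
    c % suc a                     ∎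
  ℓ≤L : ℓ ≤ L
  ℓ≤L = ≮⇒≥ (λ L<ℓ → ℓ-least L L<ℓ L-solves)
  a∣L∸ℓ : suc a ∣ L ∸ ℓ
  a∣L∸ℓ = coprime-divisor a⊥b
    (subst (suc a ∣_) (trans (sym (*-distribʳ-∸ b L ℓ)) (*-comm (L ∸ ℓ) b))
           (%≡%⇒∣∸ {L * b} {ℓ * b} (trans L-solves (sym ℓ-solves))))
  L∸ℓ≡0 : L ∸ ℓ ≡ 0
  L∸ℓ≡0 = trans (sym (m<n⇒m%n≡m (≤-<-trans (m∸n≤m L ℓ) L<a))) (n∣m⇒m%n≡0 (L ∸ ℓ) (suc a) a∣L∸ℓ)

fib-+ : ∀ j m → fib (suc j + m) ≡ fib j * fib m + fib (suc j) * fib (suc m)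
fib-+ zero          m = sym (+-identityʳ (fib (suc m)))
fib-+ (suc zero)    m = base (fib m) (fib (suc m))
  where
  base : ∀ s t → t + s ≡ 1 * s + 1 * t
  base = solve-∀
fib-+ (suc (suc j)) m = trans (cong₂ _+_ (fib-+ (suc j) m) (fib-+ j m))
                              (regroup (fib (suc j)) (fib (2 + j)) (fib j) (fib (suc j)) (fib m) (fib (suc m)))
  where
  regroup : ∀ a b c d s t → (a * s + b * t) + (c * s + d * t) ≡ (a + c) * s + (b + d) * t
  regroup = solve-∀

fib-suc-pos : ∀ m → 0 < fib (suc m)
fib-suc-pos zero    = s≤s z≤n
fib-suc-pos (suc m) = ≤-trans (fib-suc-pos m) (m≤m+n (fib (suc m)) (fib m))

fib-coprime : ∀ m → Coprime (fib m) (fib (suc m))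
fib-coprime zero    = coprime-sym (1-coprimeTo 0)
fib-coprime (suc m) = coprime-sym (coprime-+ (fib-coprime m))

cassini-step : ∀ m → fib m * fib (2 + m) + fib (1 + m) * fib (3 + m)
                   ≡ fib (1 + m) * fib (1 + m) + fib (2 + m) * fib (2 + m)
cassini-step m = identity (fib m) (fib (suc m))
  where
  identity : ∀ p q → p * (q + p) + q * (q + p + q) ≡ q * q + (q + p) * (q + p)
  identity = solve-∀

cassini-even : ∀ i → fib (i * 2) * fib (2 + i * 2) + 1 ≡ fib (1 + i * 2) * fib (1 + i * 2)
cassini-odd  : ∀ i → fib (1 + i * 2) * fib (3 + i * 2) ≡ fib (2 + i * 2) * fib (2 + i * 2) + 1

cassini-even zero    = refl
cassini-even (suc i) = +-cancelˡ-≡ (F₂ * F₂) _ _ (begin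
  F₂ * F₂ + (F₂ * F₄ + 1)      ≡⟨ cong (F₂ * F₂ +_) (+-comm (F₂ * F₄) 1) ⟩
  F₂ * F₂ + (1 + F₂ * F₄)      ≡⟨ +-assoc (F₂ * F₂) 1 (F₂ * F₄) ⟨
  F₂ * F₂ + 1 + F₂ * F₄        ≡⟨ cong (_+ F₂ * F₄) (cassini-odd i) ⟨
  F₁ * F₃ + F₂ * F₄            ≡⟨ cassini-step (1 + i * 2) ⟩
  F₂ * F₂ + F₃ * F₃            ∎)
  where
  open ≡-Reasoning
  F₁ F₂ F₃ F₄ : ℕ
  F₁ = fib (1 + i * 2)
  F₂ = fib (2 + i * 2)
  F₃ = fib (3 + i * 2)
  F₄ = fib (4 + i * 2)

cassini-odd i = +-cancelˡ-≡ (F₁ * F₁) _ _ (begin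
  F₁ * F₁ + F₁ * F₃            ≡⟨ cong (_+ F₁ * F₃) (cassini-even i) ⟨
  F₀ * F₂ + 1 + F₁ * F₃        ≡⟨ +-assoc (F₀ * F₂) 1 (F₁ * F₃) ⟩
  F₀ * F₂ + (1 + F₁ * F₃)      ≡⟨ cong (F₀ * F₂ +_) (+-comm 1 (F₁ * F₃)) ⟩
  F₀ * F₂ + (F₁ * F₃ + 1)      ≡⟨ +-assoc (F₀ * F₂) (F₁ * F₃) 1 ⟨
  F₀ * F₂ + F₁ * F₃ + 1        ≡⟨ cong (_+ 1) (cassini-step (i * 2)) ⟩
  F₁ * F₁ + F₂ * F₂ + 1        ≡⟨ +-assoc (F₁ * F₁) (F₂ * F₂) 1 ⟩
  F₁ * F₁ + (F₂ * F₂ + 1)      ∎)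
  where
  open ≡-Reasoning
  F₀ F₁ F₂ F₃ : ℕ
  F₀ = fib (i * 2)
  F₁ = fib (1 + i * 2)
  F₂ = fib (2 + i * 2)
  F₃ = fib (3 + i * 2)

-- Here s = Fₙ₋₄ and t = Fₙ₋₃, so that x, w, z are Fₙ, Fₙ₊₁, Fₙ₊₂ and t + s + t is Fₙ₋₁.
least-solution-even′ : ∀ s t {ℓ} → 0 < t → s * (t + s) + 1 ≡ t * t →
  let x = 2 * s + 3 * t; w = 3 * s + 5 * t; z = 5 * s + 8 * t in
  Coprime x w → IsLeastSol (x * x) (w * w) (z * z) ℓ → ℓ ≡ 1 + x * t
least-solution-even′ s zero    ()
least-solution-even′ s (suc u) _ cassini x⊥w sol =
  least-solution-unique (1 + x * t) 4 (2 * x * t + t * y) (coprime-squares x⊥w) sol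
    (eliminate (x * t) cassini (congruence s t)) (<-slack _ (bound s u))
  where
  t x y : ℕ
  t = suc u
  x = 2 * s + 3 * t
  y = t + s + t
  -- (1 + x t) w² − z² = (2 x t + t y − 4) x² + x t (t² − s (t + s) − 1), and Cassini kills the last term.
  congruence : ∀ s t → let x = 2 * s + 3 * t; y = t + s + t; w = 3 * s + 5 * t; z = 5 * s + 8 * t in
    (1 + x * t) * (w * w) + 4 * (x * x) + x * t * (s * (t + s) + 1)
      ≡ z * z + (2 * x * t + t * y) * (x * x) + x * t * (t * t)
  congruence = solve-∀
  bound : ∀ s u → let x = 2 * s + 3 * suc u in
    suc (1 + x * suc u + (2 * x * s + 2 * x * u + 4 * s + 6 * u + 4)) ≡ x * x
  bound = solve-∀

least-solution-odd′ : ∀ s t {ℓ} → 0 < t → s * (t + s) ≡ t * t + 1 →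
  let x = 2 * s + 3 * t; w = 3 * s + 5 * t; z = 5 * s + 8 * t in
  Coprime x w → IsLeastSol (x * x) (w * w) (z * z) ℓ → ℓ ≡ 1 + 2 * x * (t + s)
least-solution-odd′ s zero    ()
least-solution-odd′ s (suc u) _ cassini x⊥w sol =
  least-solution-unique (1 + 2 * x * (t + s)) 5 (4 * x * (t + s) + 2 * (t + s) * y)
    (coprime-squares x⊥w) sol (eliminate (2 * x * (t + s)) cassini (congruence s t)) (<-slack _ (bound s u))
  where
  t x y : ℕ
  t = suc u
  x = 2 * s + 3 * t
  y = t + s + t
  congruence : ∀ s t → let x = 2 * s + 3 * t; y = t + s + t; w = 3 * s + 5 * t; z = 5 * s + 8 * t in
    (1 + 2 * x * (t + s)) * (w * w) + 5 * (x * x) + 2 * x * (t + s) * (s * (t + s))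
      ≡ z * z + (4 * x * (t + s) + 2 * (t + s) * y) * (x * x) + 2 * x * (t + s) * (t * t + 1)
  congruence = solve-∀
  bound : ∀ s u → let x = 2 * s + 3 * suc u in
    suc (1 + 2 * x * (suc u + s) + (x * u + 2 * s + 3 * u + 1)) ≡ x * x
  bound = solve-∀

least-solution-even : ∀ i {ℓ} → let n = 4 + i * 2 in
  IsLeastSol (fib n ^ 2) (fib (suc n) ^ 2) (fib (suc (suc n)) ^ 2) ℓ → ℓ ≡ 1 + fib n * fib (n ∸ 3)
-- Larger indices are rewritten first, since abstracting fib (4 + m) would unfold fib (5 + m).
least-solution-even i
  rewrite m^2≡m*m (fib (6 + i * 2)) | m^2≡m*m (fib (5 + i * 2)) | m^2≡m*m (fib (4 + i * 2))
        | fib-+ 5 (i * 2) | fib-+ 4 (i * 2) | fib-+ 3 (i * 2)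
  = least-solution-even′ (fib (i * 2)) (fib (1 + i * 2)) (fib-suc-pos (i * 2)) (cassini-even i)
      (subst₂ Coprime (fib-+ 3 (i * 2)) (fib-+ 4 (i * 2)) (fib-coprime (4 + i * 2)))

least-solution-odd : ∀ i {ℓ} → let n = 5 + i * 2 in
  IsLeastSol (fib n ^ 2) (fib (suc n) ^ 2) (fib (suc (suc n)) ^ 2) ℓ → ℓ ≡ 1 + 2 * fib n * fib (n ∸ 2)
least-solution-odd i
  rewrite m^2≡m*m (fib (7 + i * 2)) | m^2≡m*m (fib (6 + i * 2)) | m^2≡m*m (fib (5 + i * 2))
        | fib-+ 5 (1 + i * 2) | fib-+ 4 (1 + i * 2) | fib-+ 3 (1 + i * 2)
  = least-solution-odd′ (fib (1 + i * 2)) (fib (2 + i * 2)) (fib-suc-pos (1 + i * 2)) (cassini-odd i)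
      (subst₂ Coprime (fib-+ 3 (1 + i * 2)) (fib-+ 4 (1 + i * 2)) (fib-coprime (5 + i * 2)))

q r q̄ r̄ : ℕ → ℕ → ℕ
q a ℓ = floorDiv a (a ∸ ℓ)
r a ℓ = a ∸ q a ℓ * (a ∸ ℓ)
q̄ a ℓ = floorDiv a ℓ
r̄ a ℓ = a ∸ q̄ a ℓ * ℓ

-- Here s = Fₙ₋₆ and t = Fₙ₋₅, so that x = Fₙ, t + s + t = Fₙ₋₃ and (t + s + t) + (t + s) = Fₙ₋₂.
even-quotients′ : ∀ s t → 0 < s → let x = 5 * s + 8 * t; a = x * x; ℓ = 1 + x * (t + s + t) in
  (q a ℓ ≡ 1 × r a ℓ ≡ ℓ) × (q̄ a ℓ ≡ 4 × r̄ a ℓ + 4 ≡ x * s)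
even-quotients′ zero    t ()
even-quotients′ (suc v) t _ =
  let q̄≡4 , r̄≡ρ = floorDiv-unique (division v t) (<-slack _ (remainder-bound v t))
  in floorDiv-by-large-complement (<-slack _ (complement-bound v t))
   , q̄≡4 , trans (cong (_+ 4) r̄≡ρ) (remainder v t)
  where
  complement-bound : ∀ v t → let s = suc v; x = 5 * s + 8 * t; ℓ = 1 + x * (t + s + t) in
    suc (ℓ + ℓ + (3 * x * v + 4 * x * t + 15 * v + 24 * t + 12)) ≡ x * x
  complement-bound = solve-∀
  division : ∀ v t → let s = suc v; x = 5 * s + 8 * t; ℓ = 1 + x * (t + s + t) in
    x * x ≡ (x * v + 5 * v + 8 * t + 1) + 4 * ℓ
  division = solve-∀
  remainder-bound : ∀ v t → let s = suc v; x = 5 * s + 8 * t; ℓ = 1 + x * (t + s + t) in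
    suc (x * v + 5 * v + 8 * t + 1 + (2 * x * t + 4)) ≡ ℓ
  remainder-bound = solve-∀
  remainder : ∀ v t → let s = suc v; x = 5 * s + 8 * t in
    x * v + 5 * v + 8 * t + 1 + 4 ≡ x * s
  remainder = solve-∀

odd-quotients′ : ∀ s t → 0 < t →
  let x = 5 * s + 8 * t; p = t + s + t; a = x * x; ℓ = 1 + 2 * x * (p + (t + s)) in
  (q a ℓ ≡ 4 × r a ℓ ≡ x * s + 4) × (q̄ a ℓ ≡ 1 × r̄ a ℓ + 1 ≡ x * p)
odd-quotients′ s zero    ()
odd-quotients′ s (suc u) _ =
  let q̄≡1 , r̄≡δ = floorDiv-unique (trans (complement s u) (cong (δ +_) (sym (*-identityˡ ℓ))))
                                  (<-slack _ (complement-bound s u))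
  in floorDiv-by-complement (complement s u) (division s u) (<-slack _ (remainder-bound s u))
   , q̄≡1 , trans (cong (_+ 1) r̄≡δ) (complement-suc s u)
  where
  δ ℓ : ℕ
  δ = let x = 5 * s + 8 * suc u in x * s + 2 * x * u + 10 * s + 16 * u + 15
  ℓ = let t = suc u; x = 5 * s + 8 * t in 1 + 2 * x * (t + s + t + (t + s))
  complement : ∀ s u → let t = suc u; x = 5 * s + 8 * t; ℓ = 1 + 2 * x * (t + s + t + (t + s)) in
    x * x ≡ (x * s + 2 * x * u + 10 * s + 16 * u + 15) + ℓ
  complement = solve-∀
  complement-bound : ∀ s u → let t = suc u; x = 5 * s + 8 * t; ℓ = 1 + 2 * x * (t + s + t + (t + s)) in
    suc (x * s + 2 * x * u + 10 * s + 16 * u + 15 + (1 + x * (3 * s + 4 * t))) ≡ ℓ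
  complement-bound = solve-∀
  complement-suc : ∀ s u → let t = suc u; x = 5 * s + 8 * t in
    x * s + 2 * x * u + 10 * s + 16 * u + 15 + 1 ≡ x * (t + s + t)
  complement-suc = solve-∀
  division : ∀ s u → let x = 5 * s + 8 * suc u in
    x * x ≡ (x * s + 4) + 4 * (x * s + 2 * x * u + 10 * s + 16 * u + 15)
  division = solve-∀
  remainder-bound : ∀ s u → let x = 5 * s + 8 * suc u in
    suc (x * s + 4 + (2 * x * u + 10 * s + 16 * u + 10)) ≡ x * s + 2 * x * u + 10 * s + 16 * u + 15
  remainder-bound = solve-∀

even-quotients : ∀ m → let n = 7 + m; x = fib n; a = x ^ 2; ℓ = 1 + x * fib (n ∸ 3) in
  (q a ℓ ≡ 1 × r a ℓ ≡ ℓ) × (q̄ a ℓ ≡ 4 × r̄ a ℓ + 4 ≡ x * fib (n ∸ 6))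
even-quotients m rewrite m^2≡m*m (fib (7 + m)) | fib-+ 5 (suc m) =
  even-quotients′ (fib (suc m)) (fib (2 + m)) (fib-suc-pos m)

odd-quotients : ∀ m → let n = 7 + m; x = fib n; a = x ^ 2; ℓ = 1 + 2 * x * fib (n ∸ 2) in
  (q a ℓ ≡ 4 × r a ℓ ≡ x * fib (n ∸ 6) + 4) × (q̄ a ℓ ≡ 1 × r̄ a ℓ + 1 ≡ x * fib (n ∸ 3))
odd-quotients m rewrite m^2≡m*m (fib (7 + m)) | fib-+ 5 (suc m) =
  odd-quotients′ (fib (suc m)) (fib (2 + m)) (fib-suc-pos (suc m))

EvenConclusion OddConclusion : ℕ → ℕ → Set
EvenConclusion n ℓ = let a = fib n ^ 2 in
  q a ℓ ≡ 1 × r a ℓ ≡ ℓ ×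
  (n ≡ 4 → q̄ a ℓ ≡ 2 × r̄ a ℓ ≡ 1) ×
  (n ≡ 6 → q̄ a ℓ ≡ 3 × r̄ a ℓ ≡ 13) ×
  (8 ≤ n → q̄ a ℓ ≡ 4 × r̄ a ℓ + 4 ≡ fib n * fib (n ∸ 6))
OddConclusion n ℓ = let a = fib n ^ 2 in
  (n ≡ 5 → q a ℓ ≡ 6 × r a ℓ ≡ 1) ×
  (7 ≤ n → q a ℓ ≡ 4 × r a ℓ ≡ fib n * fib (n ∸ 6) + 4) ×
  q̄ a ℓ ≡ 1 × r̄ a ℓ + 1 ≡ fib n * fib (n ∸ 3)

even-conclusion : ∀ i → let n = 4 + i * 2 in EvenConclusion n (1 + fib n * fib (n ∸ 3))
even-conclusion 0 = refl , refl , (λ _ → refl , refl) , (λ ()) , ⊥-elim ∘ from-no (8 ≤? 4)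
even-conclusion 1 = refl , refl , (λ ()) , (λ _ → refl , refl) , ⊥-elim ∘ from-no (8 ≤? 6)
even-conclusion (suc (suc i)) =
  let (q≡1 , r≡ℓ) , q̄-r̄ = even-quotients (1 + i * 2) in q≡1 , r≡ℓ , (λ ()) , (λ ()) , λ _ → q̄-r̄

odd-conclusion : ∀ i → let n = 5 + i * 2 in OddConclusion n (1 + 2 * fib n * fib (n ∸ 2))
odd-conclusion zero    = (λ _ → refl , refl) , ⊥-elim ∘ from-no (7 ≤? 5) , refl , refl
odd-conclusion (suc i) = let q-r , q̄-r̄ = odd-quotients (i * 2) in (λ ()) , (λ _ → q-r) , q̄-r̄

data Parity : ℕ → Set where
  even : ∀ i → Parity (i * 2)
  odd  : ∀ i → Parity (1 + i * 2)

parity : ∀ k → Parity k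
parity zero = even 0
parity (suc k) with parity k
... | even i = odd i
... | odd i  = even (suc i)

lemma4p13 : (n : ℕ) → 4 ≤ n → (ℓ : ℕ) →
    IsLeastSol (fib n ^ 2) (fib (suc n) ^ 2) (fib (suc (suc n)) ^ 2) ℓ →
    let a = fib n ^ 2
        q = floorDiv a (a ∸ ℓ)
        r = a ∸ q * (a ∸ ℓ)
        qb = floorDiv a ℓ
        rb = a ∸ qb * ℓ
    in (n % 2 ≡ 0 →
          q ≡ 1 × r ≡ ℓ ×
          (n ≡ 4 → qb ≡ 2 × rb ≡ 1) ×
          (n ≡ 6 → qb ≡ 3 × rb ≡ 13) ×
          (8 ≤ n → qb ≡ 4 × rb + 4 ≡ fib n * fib (n ∸ 6)))
     × (n % 2 ≡ 1 →
          (n ≡ 5 → q ≡ 6 × r ≡ 1) ×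
          (7 ≤ n → q ≡ 4 × r ≡ fib n * fib (n ∸ 6) + 4) ×
          qb ≡ 1 × rb + 1 ≡ fib n * fib (n ∸ 3))
lemma4p13 _ (s≤s (s≤s (s≤s (s≤s {n = k} z≤n)))) ℓ sol with parity k
... | even i = (λ _ → subst (EvenConclusion _) (sym (least-solution-even i sol)) (even-conclusion i)) ,
               λ n%2≡1 → contradiction (trans (sym ([m+kn]%n≡m%n 4 i 2)) n%2≡1) λ ()
... | odd i  = (λ n%2≡0 → contradiction (trans (sym ([m+kn]%n≡m%n 5 i 2)) n%2≡0) λ ()) ,
               λ _ → subst (OddConclusion _) (sym (least-solution-odd i sol)) (odd-conclusion i)
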